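{- For integers $0\le d\le n$ define $$g_{n,d}(t)=\sum_{i=1}^{\min(d,n-d)} \frac{(n-i-1)!}{(d-i)!\,(n-d-i)!\,(i-1)!}\, t^i$$ (empty sum $=0$). Then for $n\ge 3$ and $2\le d\le n-1$, $$g_{n,d}(t)=\frac{n-d}{d-1}\, g_{n,d-1}(t)+\frac{t(n+1-2d)}{d-1}\, g_{n-1,d-1}(t),$$ $$g_{n,d}(t)=\frac{(d-1)(n-d)}{(n-2d)(n+1-2d)t+(d-1)^2}\, g_{n,d-1}(t)+\frac{(n+1-2d)(n-1-d)t}{(n-2d)(n+1-2d)t+(d-1)^2}\, g_{n-1,d}(t).$$
   Context: $g_{n,d}$ is Speyer's $g$-polynomial of the uniform matroid $U_{n,d}$. The second identity is an identity of rational functions in $t$. -}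

module Defs where

open import Data.Nat as ℕ using (ℕ; zero; suc; _∸_; _⊓_; _!; _≤_; s≤s; z≤n; NonZero)
open import Data.Nat.Properties using (_!≢0; m*n≢0)
open import Data.Integer as ℤ using (ℤ; +_)
open import Data.Rational as ℚ using (ℚ; 0ℚ; 1ℚ; _/_; _+_; _*_)

_^_ : ℚ → ℕ → ℚ
x ^ zero = 1ℚ
x ^ suc k = x * (x ^ k)

sum1to : ℕ → (ℕ → ℚ) → ℚ
sum1to zero f = 0ℚ
sum1to (suc m) f = sum1to m f + f (suc m)

-- the rational number (n-i-1)! / ((d-i)! (n-d-i)! (i-1)!)
-- (the subtractions are exact in the summation range 1 ≤ i ≤ min(d, n-d))
gcoef : ℕ → ℕ → ℕ → ℚ
gcoef n d i =
  let a = (d ∸ i) ! ; b = (n ∸ d ∸ i) ! ; c = (i ∸ 1) ! in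
  let instance
        _ = (d ∸ i) !≢0
        _ = (n ∸ d ∸ i) !≢0
        _ = (i ∸ 1) !≢0
        _ = m*n≢0 a b
        _ = m*n≢0 (a ℕ.* b) c
  in (+ ((n ∸ i ∸ 1) !)) / (a ℕ.* b ℕ.* c)

g : ℕ → ℕ → ℚ → ℚ
g n d t = sum1to (d ⊓ (n ∸ d)) (λ i → gcoef n d i * (t ^ i))

ι : ℤ → ℚ
ι z = z / 1

2≤⇒pred-nonZero : ∀ {d} → 2 ≤ d → NonZero (d ∸ 1)
2≤⇒pred-nonZero (s≤s (s≤s z≤n)) = _

{-# OPTIONS --safe #-}
-- The coefficient of t^i in g_{n,d} is the multinomial coefficient of the parts
-- (d-i, n-d-i, i-1), whose sum is n-i-1. Extending multinomial coefficients by zero to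
-- parts in ℤ lets every polynomial in the recurrences be summed over the common range
-- 1 ≤ i ≤ n-1, so that both identities reduce to identities between coefficients.
-- These follow from the absorption rule x·M(x,y,z) = (x+y+z)·M(x-1,y,z) and its
-- symmetric versions: multiplying a coefficient identity by the sum of the parts (once for
-- the first recurrence, twice for the second) turns every term into a polynomial multiple of
-- a single multinomial coefficient, and what remains is a polynomial identity.
module Submission where

open import Defs
open import Data.Nat as ℕ using (ℕ; zero; suc; _∸_; _⊓_; _!; _≤_; _<_; z≤n; s≤s)
import Data.Nat.Properties as ℕP
open import Data.Nat.Combinatorics using (_C_; nCk≡n!/k![n-k]!; k![n∸k]!∣n!)
open import Data.Nat.DivMod using (m/n*n≡m)
import Data.Nat.Tactic.RingSolver as ℕ-Solver
open import Algebra.Properties.CommutativeSemigroup ℕP.*-commutativeSemigroup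
  using (xy∙z≈yx∙z; xy∙z≈xz∙y)
open import Data.Integer as ℤ using (ℤ; +_; -[1+_]; 0ℤ; 1ℤ)
import Data.Integer.Properties as ℤP
import Data.Integer.Tactic.RingSolver as ℤ-Solver
open import Data.List.Base using (_∷_; [])
open import Data.Maybe.Base using (nothing)
open import Data.Product.Base using (_×_; _,_)
open import Data.Sum.Base using (inj₁; inj₂)
open import Level using (0ℓ)
open import Relation.Nullary using (yes; no)
open import Relation.Binary.PropositionalEquality

nCk*k![n∸k]!≡n! : ∀ {n k} → k ≤ n → (n C k) ℕ.* (k ! ℕ.* (n ∸ k) !) ≡ n !
nCk*k![n∸k]!≡n! {n} {k} k≤n =
  trans (cong (ℕ._* (k ! ℕ.* (n ∸ k) !)) (nCk≡n!/k![n-k]! k≤n))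
        (m/n*n≡m {{k ℕP.!* (n ∸ k) !≢0}} (k![n∸k]!∣n! k≤n))

[m+n]Cn*n!*m!≡[m+n]! : ∀ m n → ((m ℕ.+ n) C n) ℕ.* (n ! ℕ.* m !) ≡ (m ℕ.+ n) !
[m+n]Cn*n!*m!≡[m+n]! m n = begin
  ((m ℕ.+ n) C n) ℕ.* (n ! ℕ.* m !)
    ≡⟨ cong (λ k → ((m ℕ.+ n) C n) ℕ.* (n ! ℕ.* k !)) (ℕP.m+n∸n≡m m n) ⟨
  ((m ℕ.+ n) C n) ℕ.* (n ! ℕ.* (m ℕ.+ n ∸ n) !)
    ≡⟨ nCk*k![n∸k]!≡n! (ℕP.m≤n+m n m) ⟩
  (m ℕ.+ n) ! ∎
  where open ≡-Reasoning

multinomial : ℕ → ℕ → ℕ → ℕ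
multinomial a b c = ((a ℕ.+ b ℕ.+ c) C c) ℕ.* ((a ℕ.+ b) C b)

a!b!c!≢0 : ∀ a b c → ℕ.NonZero (a ! ℕ.* b ! ℕ.* c !)
a!b!c!≢0 a b c = ℕP.m*n≢0 (a ! ℕ.* b !) (c !) {{a ℕP.!* b !≢0}} {{c ℕP.!≢0}}

multinomial-spec : ∀ a b c → multinomial a b c ℕ.* (a ! ℕ.* b ! ℕ.* c !) ≡ (a ℕ.+ b ℕ.+ c) !
multinomial-spec a b c = begin
  ((a ℕ.+ b ℕ.+ c) C c) ℕ.* ((a ℕ.+ b) C b) ℕ.* (a ! ℕ.* b ! ℕ.* c !)
    ≡⟨ regroup ((a ℕ.+ b ℕ.+ c) C c) ((a ℕ.+ b) C b) (a !) (b !) (c !) ⟩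
  ((a ℕ.+ b ℕ.+ c) C c) ℕ.* (c ! ℕ.* (((a ℕ.+ b) C b) ℕ.* (b ! ℕ.* a !)))
    ≡⟨ cong (λ k → ((a ℕ.+ b ℕ.+ c) C c) ℕ.* (c ! ℕ.* k)) ([m+n]Cn*n!*m!≡[m+n]! a b) ⟩
  ((a ℕ.+ b ℕ.+ c) C c) ℕ.* (c ! ℕ.* (a ℕ.+ b) !)
    ≡⟨ [m+n]Cn*n!*m!≡[m+n]! (a ℕ.+ b) c ⟩
  (a ℕ.+ b ℕ.+ c) ! ∎
  where
  open ≡-Reasoning
  regroup : ∀ x y u v w → x ℕ.* y ℕ.* (u ℕ.* v ℕ.* w) ≡ x ℕ.* (w ℕ.* (y ℕ.* (v ℕ.* u)))
  regroup = ℕ-Solver.solve-∀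

multinomial-unique : ∀ a b c m → m ℕ.* (a ! ℕ.* b ! ℕ.* c !) ≡ (a ℕ.+ b ℕ.+ c) ! →
                     m ≡ multinomial a b c
multinomial-unique a b c m eq =
  ℕP.*-cancelʳ-≡ m (multinomial a b c) (a ! ℕ.* b ! ℕ.* c !) {{a!b!c!≢0 a b c}}
    (trans eq (sym (multinomial-spec a b c)))

multinomial-down₁ : ∀ a b c →
  suc a ℕ.* multinomial (suc a) b c ≡ suc (a ℕ.+ b ℕ.+ c) ℕ.* multinomial a b c
multinomial-down₁ a b c = ℕP.*-cancelʳ-≡ _ _ (a ! ℕ.* b ! ℕ.* c !) {{a!b!c!≢0 a b c}} (begin
  suc a ℕ.* multinomial (suc a) b c ℕ.* (a ! ℕ.* b ! ℕ.* c !)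
    ≡⟨ regroup (suc a) (multinomial (suc a) b c) (a !) (b !) (c !) ⟩
  multinomial (suc a) b c ℕ.* ((suc a) ! ℕ.* b ! ℕ.* c !)
    ≡⟨ multinomial-spec (suc a) b c ⟩
  suc (a ℕ.+ b ℕ.+ c) ℕ.* (a ℕ.+ b ℕ.+ c) !
    ≡⟨ cong (suc (a ℕ.+ b ℕ.+ c) ℕ.*_) (multinomial-spec a b c) ⟨
  suc (a ℕ.+ b ℕ.+ c) ℕ.* (multinomial a b c ℕ.* (a ! ℕ.* b ! ℕ.* c !))
    ≡⟨ ℕP.*-assoc (suc (a ℕ.+ b ℕ.+ c)) (multinomial a b c) (a ! ℕ.* b ! ℕ.* c !) ⟨
  suc (a ℕ.+ b ℕ.+ c) ℕ.* multinomial a b c ℕ.* (a ! ℕ.* b ! ℕ.* c !) ∎)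
  where
  open ≡-Reasoning
  regroup : ∀ x m u v w → x ℕ.* m ℕ.* (u ℕ.* v ℕ.* w) ≡ m ℕ.* (x ℕ.* u ℕ.* v ℕ.* w)
  regroup = ℕ-Solver.solve-∀

multinomial-swap₁₂ : ∀ a b c → multinomial a b c ≡ multinomial b a c
multinomial-swap₁₂ a b c = multinomial-unique b a c (multinomial a b c) (begin
  multinomial a b c ℕ.* (b ! ℕ.* a ! ℕ.* c !)
    ≡⟨ cong (multinomial a b c ℕ.*_) (xy∙z≈yx∙z (b !) (a !) (c !)) ⟩
  multinomial a b c ℕ.* (a ! ℕ.* b ! ℕ.* c !)
    ≡⟨ multinomial-spec a b c ⟩
  (a ℕ.+ b ℕ.+ c) !
    ≡⟨ cong (λ k → (k ℕ.+ c) !) (ℕP.+-comm a b) ⟩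
  (b ℕ.+ a ℕ.+ c) ! ∎)
  where open ≡-Reasoning

multinomial-swap₂₃ : ∀ a b c → multinomial a b c ≡ multinomial a c b
multinomial-swap₂₃ a b c = multinomial-unique a c b (multinomial a b c) (begin
  multinomial a b c ℕ.* (a ! ℕ.* c ! ℕ.* b !)
    ≡⟨ cong (multinomial a b c ℕ.*_) (xy∙z≈xz∙y (a !) (c !) (b !)) ⟩
  multinomial a b c ℕ.* (a ! ℕ.* b ! ℕ.* c !)
    ≡⟨ multinomial-spec a b c ⟩
  (a ℕ.+ b ℕ.+ c) !
    ≡⟨ cong _! a+b+c≡a+c+b ⟩
  (a ℕ.+ c ℕ.+ b) ! ∎)
  where
  open ≡-Reasoning
  a+b+c≡a+c+b : a ℕ.+ b ℕ.+ c ≡ a ℕ.+ c ℕ.+ b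
  a+b+c≡a+c+b = ℕ-Solver.solve (a ∷ b ∷ c ∷ [])

module Coefficients where
  open import Data.Integer using (_+_; _*_; _-_; NonZero)
  open ℤ-Solver using (solve)
  open ≡-Reasoning

  multinomialℤ : ℤ → ℤ → ℤ → ℤ
  multinomialℤ (+ a) (+ b) (+ c) = + multinomial a b c
  multinomialℤ _     _     _     = 0ℤ

  multinomialℤ-cong : ∀ {x x′ y y′ z z′} → x ≡ x′ → y ≡ y′ → z ≡ z′ →
                      multinomialℤ x y z ≡ multinomialℤ x′ y′ z′
  multinomialℤ-cong refl refl refl = refl

  multinomialℤ-vanishes₂ : ∀ x k z → multinomialℤ x -[1+ k ] z ≡ 0ℤ
  multinomialℤ-vanishes₂ (+ a)    k z = refl
  multinomialℤ-vanishes₂ -[1+ a ] k z = refl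

  multinomialℤ-vanishes₃ : ∀ x y k → multinomialℤ x y -[1+ k ] ≡ 0ℤ
  multinomialℤ-vanishes₃ (+ a)    (+ b)    k = refl
  multinomialℤ-vanishes₃ (+ a)    -[1+ b ] k = refl
  multinomialℤ-vanishes₃ -[1+ a ] y        k = refl

  multinomialℤ-swap₁₂ : ∀ x y z → multinomialℤ x y z ≡ multinomialℤ y x z
  multinomialℤ-swap₁₂ (+ a)    (+ b)    (+ c)    = cong +_ (multinomial-swap₁₂ a b c)
  multinomialℤ-swap₁₂ (+ a)    (+ b)    -[1+ c ] = refl
  multinomialℤ-swap₁₂ (+ a)    -[1+ b ] z        = refl
  multinomialℤ-swap₁₂ -[1+ a ] (+ b)    z        = refl
  multinomialℤ-swap₁₂ -[1+ a ] -[1+ b ] z        = refl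

  multinomialℤ-swap₂₃ : ∀ x y z → multinomialℤ x y z ≡ multinomialℤ x z y
  multinomialℤ-swap₂₃ (+ a)    (+ b)    (+ c)    = cong +_ (multinomial-swap₂₃ a b c)
  multinomialℤ-swap₂₃ (+ a)    (+ b)    -[1+ c ] = refl
  multinomialℤ-swap₂₃ (+ a)    -[1+ b ] (+ c)    = refl
  multinomialℤ-swap₂₃ (+ a)    -[1+ b ] -[1+ c ] = refl
  multinomialℤ-swap₂₃ -[1+ a ] y        z        = refl

  x*0≡y*0 : ∀ x y → x * 0ℤ ≡ y * 0ℤ
  x*0≡y*0 x y = trans (ℤP.*-zeroʳ x) (sym (ℤP.*-zeroʳ y))

  multinomialℤ-down₁ : ∀ x y z →
    x * multinomialℤ x y z ≡ (x + y + z) * multinomialℤ (x - 1ℤ) y z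
  multinomialℤ-down₁ (+ zero)  y z = sym (ℤP.*-zeroʳ (+ 0 + y + z))
  multinomialℤ-down₁ (+ suc a) (+ b) (+ c) = begin
    + suc a * + multinomial (suc a) b c            ≡⟨ ℤP.pos-* (suc a) _ ⟨
    + (suc a ℕ.* multinomial (suc a) b c)          ≡⟨ cong +_ (multinomial-down₁ a b c) ⟩
    + (suc (a ℕ.+ b ℕ.+ c) ℕ.* multinomial a b c)  ≡⟨ ℤP.pos-* (suc (a ℕ.+ b ℕ.+ c)) _ ⟩
    + suc (a ℕ.+ b ℕ.+ c) * + multinomial a b c    ∎
  multinomialℤ-down₁ x@(+ suc _)  y@(+ _)     z@(-[1+ _ ]) = x*0≡y*0 x (x + y + z)
  multinomialℤ-down₁ x@(+ suc _)  y@(-[1+ _ ]) z           = x*0≡y*0 x (x + y + z)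
  multinomialℤ-down₁ x@(-[1+ _ ]) y           z           = x*0≡y*0 x (x + y + z)

  multinomialℤ-down₂ : ∀ x y z →
    y * multinomialℤ x y z ≡ (x + y + z) * multinomialℤ x (y - 1ℤ) z
  multinomialℤ-down₂ x y z = begin
    y * multinomialℤ x y z                   ≡⟨ cong (y *_) (multinomialℤ-swap₁₂ x y z) ⟩
    y * multinomialℤ y x z                   ≡⟨ multinomialℤ-down₁ y x z ⟩
    (y + x + z) * multinomialℤ (y - 1ℤ) x z
      ≡⟨ cong₂ _*_ (cong (_+ z) (ℤP.+-comm x y)) (multinomialℤ-swap₁₂ x (y - 1ℤ) z) ⟨
    (x + y + z) * multinomialℤ x (y - 1ℤ) z  ∎

  multinomialℤ-down₃ : ∀ x y z →
    z * multinomialℤ x y z ≡ (x + y + z) * multinomialℤ x y (z - 1ℤ)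
  multinomialℤ-down₃ x y z = begin
    z * multinomialℤ x y z                   ≡⟨ cong (z *_) (multinomialℤ-swap₂₃ x y z) ⟩
    z * multinomialℤ x z y                   ≡⟨ multinomialℤ-down₂ x z y ⟩
    (x + z + y) * multinomialℤ x (z - 1ℤ) y
      ≡⟨ cong ((x + z + y) *_) (multinomialℤ-swap₂₃ x (z - 1ℤ) y) ⟩
    (x + z + y) * multinomialℤ x y (z - 1ℤ)
      ≡⟨ cong (_* multinomialℤ x y (z - 1ℤ)) x+z+y≡x+y+z ⟩
    (x + y + z) * multinomialℤ x y (z - 1ℤ)  ∎
    where
    x+z+y≡x+y+z : x + z + y ≡ x + y + z
    x+z+y≡x+y+z = solve (x ∷ y ∷ z ∷ [])

  lower-neighbours₁ : ∀ p q r X Xp Xq Xr → .{{NonZero (p + q + r)}} →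
    p * X ≡ (p + q + r) * Xp → q * X ≡ (p + q + r) * Xq → r * X ≡ (p + q + r) * Xr →
    (p + r) * Xq ≡ (q + r) * Xp + (q - p) * Xr
  lower-neighbours₁ p q r X Xp Xq Xr hp hq hr = ℤP.*-cancelˡ-≡ (p + q + r) _ _ (begin
    (p + q + r) * ((p + r) * Xq)
      ≡⟨ solve (p ∷ q ∷ r ∷ Xq ∷ []) ⟩
    (p + r) * ((p + q + r) * Xq)
      ≡⟨ cong ((p + r) *_) hq ⟨
    (p + r) * (q * X)
      ≡⟨ solve (p ∷ q ∷ r ∷ X ∷ []) ⟩
    (q + r) * (p * X) + (q - p) * (r * X)
      ≡⟨ cong₂ (λ u v → (q + r) * u + (q - p) * v) hp hr ⟩
    (q + r) * ((p + q + r) * Xp) + (q - p) * ((p + q + r) * Xr)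
      ≡⟨ solve (p ∷ q ∷ r ∷ Xp ∷ Xr ∷ []) ⟩
    (p + q + r) * ((q + r) * Xp + (q - p) * Xr) ∎)

  multinomialℤ-identity₁ : ∀ p q r → .{{NonZero (p + q + r)}} →
    (p + r) * multinomialℤ p (q - 1ℤ) r
      ≡ (q + r) * multinomialℤ (p - 1ℤ) q r + (q - p) * multinomialℤ p q (r - 1ℤ)
  multinomialℤ-identity₁ p q r = lower-neighbours₁ p q r (multinomialℤ p q r)
    (multinomialℤ (p - 1ℤ) q r) (multinomialℤ p (q - 1ℤ) r) (multinomialℤ p q (r - 1ℤ))
    (multinomialℤ-down₁ p q r) (multinomialℤ-down₂ p q r) (multinomialℤ-down₃ p q r)

  lower-neighbours₂ : ∀ p q r X Y Z Xr Xpq Xpp Xqr →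
    .{{NonZero (p + q + r)}} → .{{NonZero (p - 1ℤ + q + r)}} →
    p * X ≡ (p + q + r) * Y → q * X ≡ (p + q + r) * Z → r * X ≡ (p + q + r) * Xr →
    q * Y ≡ (p - 1ℤ + q + r) * Xpq → (p - 1ℤ) * Y ≡ (p - 1ℤ + q + r) * Xpp →
    r * Z ≡ (p + (q - 1ℤ) + r) * Xqr →
    (q - p) * (q - p + 1ℤ) * Xr + (p - 1ℤ + r) * (p - 1ℤ + r) * Xpq
      ≡ (p - 1ℤ + r) * (q + r) * Xpp + (q - p + 1ℤ) * (q - 1ℤ + r) * Xqr
  lower-neighbours₂ p q r X Y Z Xr Xpq Xpp Xqr hp hq hr hYq hYp hZr =
    ℤP.*-cancelˡ-≡ ((p + q + r) * (p - 1ℤ + q + r)) _ _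
                   {{ℤP.i*j≢0 (p + q + r) (p - 1ℤ + q + r)}} (begin
    (p + q + r) * (p - 1ℤ + q + r)
      * ((q - p) * (q - p + 1ℤ) * Xr + (p - 1ℤ + r) * (p - 1ℤ + r) * Xpq)
      ≡⟨ solve (p ∷ q ∷ r ∷ Xr ∷ Xpq ∷ []) ⟩
    (q - p) * (q - p + 1ℤ) * (p - 1ℤ + q + r) * ((p + q + r) * Xr)
      + (p - 1ℤ + r) * (p - 1ℤ + r) * (p + q + r) * ((p - 1ℤ + q + r) * Xpq)
      ≡⟨ cong₂ _+_ (cong ((q - p) * (q - p + 1ℤ) * (p - 1ℤ + q + r) *_) hr)
                   (cong ((p - 1ℤ + r) * (p - 1ℤ + r) * (p + q + r) *_) hYq) ⟨
    (q - p) * (q - p + 1ℤ) * (p - 1ℤ + q + r) * (r * X)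
      + (p - 1ℤ + r) * (p - 1ℤ + r) * (p + q + r) * (q * Y)
      ≡⟨ solve (p ∷ q ∷ r ∷ X ∷ Y ∷ []) ⟩
    (q - p) * (q - p + 1ℤ) * (p - 1ℤ + q + r) * (r * X)
      + (p - 1ℤ + r) * (p - 1ℤ + r) * q * ((p + q + r) * Y)
      ≡⟨ cong (_+_ ((q - p) * (q - p + 1ℤ) * (p - 1ℤ + q + r) * (r * X)))
              (cong ((p - 1ℤ + r) * (p - 1ℤ + r) * q *_) hp) ⟨
    (q - p) * (q - p + 1ℤ) * (p - 1ℤ + q + r) * (r * X)
      + (p - 1ℤ + r) * (p - 1ℤ + r) * q * (p * X)
      ≡⟨ solve (p ∷ q ∷ r ∷ X ∷ []) ⟩
    (p - 1ℤ + r) * (q + r) * (p - 1ℤ) * (p * X)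
      + (q - p + 1ℤ) * (q - 1ℤ + r) * r * (q * X)
      ≡⟨ cong₂ _+_ (cong ((p - 1ℤ + r) * (q + r) * (p - 1ℤ) *_) hp)
                   (cong ((q - p + 1ℤ) * (q - 1ℤ + r) * r *_) hq) ⟩
    (p - 1ℤ + r) * (q + r) * (p - 1ℤ) * ((p + q + r) * Y)
      + (q - p + 1ℤ) * (q - 1ℤ + r) * r * ((p + q + r) * Z)
      ≡⟨ solve (p ∷ q ∷ r ∷ Y ∷ Z ∷ []) ⟩
    (p - 1ℤ + r) * (q + r) * (p + q + r) * ((p - 1ℤ) * Y)
      + (q - p + 1ℤ) * (q - 1ℤ + r) * (p + q + r) * (r * Z)
      ≡⟨ cong₂ _+_ (cong ((p - 1ℤ + r) * (q + r) * (p + q + r) *_) hYp)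
                   (cong ((q - p + 1ℤ) * (q - 1ℤ + r) * (p + q + r) *_) hZr) ⟩
    (p - 1ℤ + r) * (q + r) * (p + q + r) * ((p - 1ℤ + q + r) * Xpp)
      + (q - p + 1ℤ) * (q - 1ℤ + r) * (p + q + r) * ((p + (q - 1ℤ) + r) * Xqr)
      ≡⟨ solve (p ∷ q ∷ r ∷ Xpp ∷ Xqr ∷ []) ⟩
    (p + q + r) * (p - 1ℤ + q + r)
      * ((p - 1ℤ + r) * (q + r) * Xpp + (q - p + 1ℤ) * (q - 1ℤ + r) * Xqr) ∎)

  multinomialℤ-identity₂ : ∀ p q r → .{{NonZero (p + q + r)}} → .{{NonZero (p - 1ℤ + q + r)}} →
    (q - p) * (q - p + 1ℤ) * multinomialℤ p q (r - 1ℤ)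
      + (p - 1ℤ + r) * (p - 1ℤ + r) * multinomialℤ (p - 1ℤ) (q - 1ℤ) r
    ≡ (p - 1ℤ + r) * (q + r) * multinomialℤ (p - 1ℤ - 1ℤ) q r
      + (q - p + 1ℤ) * (q - 1ℤ + r) * multinomialℤ p (q - 1ℤ) (r - 1ℤ)
  multinomialℤ-identity₂ p q r = lower-neighbours₂ p q r
    (multinomialℤ p q r) (multinomialℤ (p - 1ℤ) q r) (multinomialℤ p (q - 1ℤ) r)
    (multinomialℤ p q (r - 1ℤ)) (multinomialℤ (p - 1ℤ) (q - 1ℤ) r)
    (multinomialℤ (p - 1ℤ - 1ℤ) q r) (multinomialℤ p (q - 1ℤ) (r - 1ℤ))
    (multinomialℤ-down₁ p q r) (multinomialℤ-down₂ p q r) (multinomialℤ-down₃ p q r)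
    (multinomialℤ-down₂ (p - 1ℤ) q r) (multinomialℤ-down₁ (p - 1ℤ) q r)
    (multinomialℤ-down₃ p (q - 1ℤ) r)

  coeffℤ : ℤ → ℤ → ℤ → ℤ
  coeffℤ N D I = multinomialℤ (D - I) (N - (D + I)) (I - 1ℤ)

  coeffℤ-level : ∀ N D I → D - I + (N - (D + I)) + (I - 1ℤ) ≡ N - (1ℤ + I)
  coeffℤ-level = ℤ-Solver.solve-∀

  coeffℤ-recurrence₁ : ∀ N D I k → N - I ≡ + suc k →
    (D - 1ℤ) * coeffℤ N D I
      ≡ (N - D) * coeffℤ N (D - 1ℤ) I + (N + 1ℤ - + 2 * D) * coeffℤ (N - 1ℤ) (D - 1ℤ) (I - 1ℤ)
  coeffℤ-recurrence₁ N D I k N-I≡1+k = begin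
    (D - 1ℤ) * coeffℤ N D I
      ≡⟨ cong₂ _*_ D-1≡p+r coeff₀ ⟩
    (p + r) * multinomialℤ p (q - 1ℤ) r
      ≡⟨ multinomialℤ-identity₁ p q r {{subst NonZero (sym p+q+r≡1+k) _}} ⟩
    (q + r) * multinomialℤ (p - 1ℤ) q r + (q - p) * multinomialℤ p q (r - 1ℤ)
      ≡⟨ cong₂ _+_ (cong₂ _*_ N-D≡q+r coeff₁) (cong₂ _*_ N+1-2D≡q-p coeff₂) ⟨
    (N - D) * coeffℤ N (D - 1ℤ) I + (N + 1ℤ - + 2 * D) * coeffℤ (N - 1ℤ) (D - 1ℤ) (I - 1ℤ) ∎
    where
    p = D - I
    q = N - (D - 1ℤ + I)
    r = I - 1ℤ
    p+q+r≡N-I : D - I + (N - (D - 1ℤ + I)) + (I - 1ℤ) ≡ N - I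
    p+q+r≡N-I = solve (N ∷ D ∷ I ∷ [])
    p+q+r≡1+k : D - I + (N - (D - 1ℤ + I)) + (I - 1ℤ) ≡ + suc k
    p+q+r≡1+k = trans p+q+r≡N-I N-I≡1+k
    D-1≡p+r : D - 1ℤ ≡ D - I + (I - 1ℤ)
    D-1≡p+r = solve (D ∷ I ∷ [])
    N-D≡q+r : N - D ≡ N - (D - 1ℤ + I) + (I - 1ℤ)
    N-D≡q+r = solve (N ∷ D ∷ I ∷ [])
    N+1-2D≡q-p : N + 1ℤ - + 2 * D ≡ N - (D - 1ℤ + I) - (D - I)
    N+1-2D≡q-p = solve (N ∷ D ∷ I ∷ [])
    coeff₀ : coeffℤ N D I ≡ multinomialℤ (D - I) (N - (D - 1ℤ + I) - 1ℤ) (I - 1ℤ)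
    coeff₀ = multinomialℤ-cong refl (solve (N ∷ D ∷ I ∷ [])) refl
    coeff₁ : coeffℤ N (D - 1ℤ) I ≡ multinomialℤ (D - I - 1ℤ) (N - (D - 1ℤ + I)) (I - 1ℤ)
    coeff₁ = multinomialℤ-cong (solve (D ∷ I ∷ [])) refl refl
    coeff₂ : coeffℤ (N - 1ℤ) (D - 1ℤ) (I - 1ℤ)
           ≡ multinomialℤ (D - I) (N - (D - 1ℤ + I)) (I - 1ℤ - 1ℤ)
    coeff₂ = multinomialℤ-cong (solve (D ∷ I ∷ [])) (solve (N ∷ D ∷ I ∷ [])) refl

  coeffℤ-recurrence₂ : ∀ N D I k → N - I ≡ + suc k →
    (N - + 2 * D) * (N + 1ℤ - + 2 * D) * coeffℤ N D (I - 1ℤ) + (D - 1ℤ) * (D - 1ℤ) * coeffℤ N D I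
      ≡ (D - 1ℤ) * (N - D) * coeffℤ N (D - 1ℤ) I
        + (N + 1ℤ - + 2 * D) * (N - 1ℤ - D) * coeffℤ (N - 1ℤ) D (I - 1ℤ)
  coeffℤ-recurrence₂ N D I k N-I≡1+k = begin
    (N - + 2 * D) * (N + 1ℤ - + 2 * D) * coeffℤ N D (I - 1ℤ) + (D - 1ℤ) * (D - 1ℤ) * coeffℤ N D I
      ≡⟨ cong₂ _+_ (cong (_* coeffℤ N D (I - 1ℤ)) P≡) (cong₂ _*_ Q≡ coeff₁) ⟩
    (q - p) * (q - p + 1ℤ) * multinomialℤ p q (r - 1ℤ)
      + (p - 1ℤ + r) * (p - 1ℤ + r) * multinomialℤ (p - 1ℤ) (q - 1ℤ) r
      ≡⟨ multinomialℤ-identity₂ p q r {{subst NonZero (sym p+q+r≡2+k) _}}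
                                      {{subst NonZero (sym p-1+q+r≡1+k) _}} ⟩
    (p - 1ℤ + r) * (q + r) * multinomialℤ (p - 1ℤ - 1ℤ) q r
      + (q - p + 1ℤ) * (q - 1ℤ + r) * multinomialℤ p (q - 1ℤ) (r - 1ℤ)
      ≡⟨ cong₂ _+_ (cong₂ _*_ A≡ coeff₂) (cong₂ _*_ B≡ coeff₃) ⟨
    (D - 1ℤ) * (N - D) * coeffℤ N (D - 1ℤ) I
      + (N + 1ℤ - + 2 * D) * (N - 1ℤ - D) * coeffℤ (N - 1ℤ) D (I - 1ℤ) ∎
    where
    p = D - (I - 1ℤ)
    q = N - (D + (I - 1ℤ))
    r = I - 1ℤ
    p+q+r≡1+N-I : D - (I - 1ℤ) + (N - (D + (I - 1ℤ))) + (I - 1ℤ) ≡ 1ℤ + (N - I)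
    p+q+r≡1+N-I = solve (N ∷ D ∷ I ∷ [])
    p+q+r≡2+k : D - (I - 1ℤ) + (N - (D + (I - 1ℤ))) + (I - 1ℤ) ≡ + suc (suc k)
    p+q+r≡2+k = trans p+q+r≡1+N-I (cong (_+_ 1ℤ) N-I≡1+k)
    p-1+q+r≡N-I : D - (I - 1ℤ) - 1ℤ + (N - (D + (I - 1ℤ))) + (I - 1ℤ) ≡ N - I
    p-1+q+r≡N-I = solve (N ∷ D ∷ I ∷ [])
    p-1+q+r≡1+k : D - (I - 1ℤ) - 1ℤ + (N - (D + (I - 1ℤ))) + (I - 1ℤ) ≡ + suc k
    p-1+q+r≡1+k = trans p-1+q+r≡N-I N-I≡1+k
    P≡ : (N - + 2 * D) * (N + 1ℤ - + 2 * D)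
       ≡ (N - (D + (I - 1ℤ)) - (D - (I - 1ℤ))) * (N - (D + (I - 1ℤ)) - (D - (I - 1ℤ)) + 1ℤ)
    P≡ = solve (N ∷ D ∷ I ∷ [])
    Q≡ : (D - 1ℤ) * (D - 1ℤ) ≡ (D - (I - 1ℤ) - 1ℤ + (I - 1ℤ)) * (D - (I - 1ℤ) - 1ℤ + (I - 1ℤ))
    Q≡ = solve (D ∷ I ∷ [])
    A≡ : (D - 1ℤ) * (N - D) ≡ (D - (I - 1ℤ) - 1ℤ + (I - 1ℤ)) * (N - (D + (I - 1ℤ)) + (I - 1ℤ))
    A≡ = solve (N ∷ D ∷ I ∷ [])
    B≡ : (N + 1ℤ - + 2 * D) * (N - 1ℤ - D)
       ≡ (N - (D + (I - 1ℤ)) - (D - (I - 1ℤ)) + 1ℤ) * (N - (D + (I - 1ℤ)) - 1ℤ + (I - 1ℤ))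
    B≡ = solve (N ∷ D ∷ I ∷ [])
    coeff₁ : coeffℤ N D I ≡ multinomialℤ (D - (I - 1ℤ) - 1ℤ) (N - (D + (I - 1ℤ)) - 1ℤ) (I - 1ℤ)
    coeff₁ = multinomialℤ-cong (solve (D ∷ I ∷ [])) (solve (N ∷ D ∷ I ∷ [])) refl
    coeff₂ : coeffℤ N (D - 1ℤ) I
           ≡ multinomialℤ (D - (I - 1ℤ) - 1ℤ - 1ℤ) (N - (D + (I - 1ℤ))) (I - 1ℤ)
    coeff₂ = multinomialℤ-cong (solve (D ∷ I ∷ [])) (solve (N ∷ D ∷ I ∷ [])) refl
    coeff₃ : coeffℤ (N - 1ℤ) D (I - 1ℤ)
           ≡ multinomialℤ (D - (I - 1ℤ)) (N - (D + (I - 1ℤ)) - 1ℤ) (I - 1ℤ - 1ℤ)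
    coeff₃ = multinomialℤ-cong refl (solve (N ∷ D ∷ I ∷ [])) refl

open Coefficients

[+m]-[+n]≡+[m∸n] : ∀ {m n} → n ≤ m → + m ℤ.- + n ≡ + (m ∸ n)
[+m]-[+n]≡+[m∸n] {m} {n} n≤m = trans (ℤP.[+m]-[+n]≡m⊖n m n) (ℤP.⊖-≥ n≤m)

[+m]-[+n]≡+[1+m∸1+n] : ∀ {m n} → n < m → + m ℤ.- + n ≡ + suc (m ∸ suc n)
[+m]-[+n]≡+[1+m∸1+n] n<m = trans ([+m]-[+n]≡+[m∸n] (ℕP.<⇒≤ n<m)) (cong +_ (ℕP.+-∸-assoc 1 n<m))

[+m]-[+n]≡-[1+n∸1+m] : ∀ {m n} → m < n → + m ℤ.- + n ≡ -[1+ (n ∸ suc m) ]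
[+m]-[+n]≡-[1+n∸1+m] {m} {n} m<n = begin
  + m ℤ.- + n         ≡⟨ ℤP.[+m]-[+n]≡m⊖n m n ⟩
  m ℤ.⊖ n             ≡⟨ ℤP.⊖-< m<n ⟩
  ℤ.- + (n ∸ m)       ≡⟨ cong (λ k → ℤ.- + k) (ℕP.+-∸-assoc 1 m<n) ⟩
  -[1+ (n ∸ suc m) ]  ∎
  where open ≡-Reasoning

coeff : ℕ → ℕ → ℕ → ℤ
coeff n d i = coeffℤ (+ n) (+ d) (+ i)

coeff-zero : ∀ n d → coeff n d 0 ≡ 0ℤ
coeff-zero n d = multinomialℤ-vanishes₃ (+ d ℤ.- + 0) (+ n ℤ.- + (d ℕ.+ 0)) 0

coeff-vanishes : ∀ n d i → d ⊓ (n ∸ d) < i → coeff n d i ≡ 0ℤ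
coeff-vanishes n d i min<i with d ℕP.<? i
... | yes d<i =
  cong (λ x → multinomialℤ x (+ n ℤ.- + (d ℕ.+ i)) (+ i ℤ.- 1ℤ)) ([+m]-[+n]≡-[1+n∸1+m] d<i)
... | no d≮i  =
  trans (cong (λ y → multinomialℤ (+ d ℤ.- + i) y (+ i ℤ.- 1ℤ)) ([+m]-[+n]≡-[1+n∸1+m] n<d+i))
        (multinomialℤ-vanishes₂ (+ d ℤ.- + i) _ (+ i ℤ.- 1ℤ))
  where
  n∸d<i : n ∸ d < i
  n∸d<i = ℕP.≰⇒> (λ i≤n∸d → ℕP.<⇒≱ min<i (ℕP.⊓-glb (ℕP.≮⇒≥ d≮i) i≤n∸d))
  n<d+i : n < d ℕ.+ i
  n<d+i = ℕP.≤-<-trans (ℕP.m≤n+m∸n n d) (ℕP.+-monoʳ-< d n∸d<i)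

coeff≡multinomial : ∀ n d j → suc j ≤ d → d ℕ.+ suc j ≤ n →
                    coeff n d (suc j) ≡ + multinomial (d ∸ suc j) (n ∸ (d ℕ.+ suc j)) j
coeff≡multinomial n d j i≤d d+i≤n =
  multinomialℤ-cong ([+m]-[+n]≡+[m∸n] i≤d) ([+m]-[+n]≡+[m∸n] d+i≤n) refl

gcoef-level : ∀ n d j → suc j ≤ d → d ℕ.+ suc j ≤ n →
              n ∸ suc j ∸ 1 ≡ (d ∸ suc j) ℕ.+ (n ∸ (d ℕ.+ suc j)) ℕ.+ j
gcoef-level n d j i≤d d+i≤n = ℤP.+-injective (begin
  + (n ∸ suc j ∸ 1)
    ≡⟨ cong +_ (trans (ℕP.∸-+-assoc n (suc j) 1) (cong (n ∸_) (ℕP.+-comm (suc j) 1))) ⟩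
  + (n ∸ (1 ℕ.+ suc j))
    ≡⟨ [+m]-[+n]≡+[m∸n] 1+i≤n ⟨
  + n ℤ.- (1ℤ ℤ.+ + suc j)
    ≡⟨ coeffℤ-level (+ n) (+ d) (+ suc j) ⟨
  + d ℤ.- + suc j ℤ.+ (+ n ℤ.- + (d ℕ.+ suc j)) ℤ.+ + j
    ≡⟨ cong₂ (λ u v → u ℤ.+ v ℤ.+ + j) ([+m]-[+n]≡+[m∸n] i≤d) ([+m]-[+n]≡+[m∸n] d+i≤n) ⟩
  + ((d ∸ suc j) ℕ.+ (n ∸ (d ℕ.+ suc j)) ℕ.+ j) ∎)
  where
  open ≡-Reasoning
  1+i≤n : 1 ℕ.+ suc j ≤ n
  1+i≤n = ℕP.≤-trans (ℕP.+-monoˡ-≤ (suc j) (ℕP.≤-trans (s≤s z≤n) i≤d)) d+i≤n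

d⊓[n∸d]≤n∸k : ∀ n d {k} → k ≤ d → d ⊓ (n ∸ d) ≤ n ∸ k
d⊓[n∸d]≤n∸k n d k≤d = ℕP.≤-trans (ℕP.m⊓n≤n d (n ∸ d)) (ℕP.∸-monoʳ-≤ n k≤d)

-- Imported only here: inside Coefficients these operator names denote the ℤ operations.
open import Data.Rational as ℚ using (ℚ; 0ℚ; 1ℚ; _/_; _÷_; _+_; _*_; 1/_; toℚᵘ; ≢-nonZero)
import Data.Rational.Properties as ℚP
import Data.Rational.Unnormalised as ℚᵘ
import Data.Rational.Unnormalised.Properties as ℚᵘP
open import Tactic.RingSolver.Core.AlmostCommutativeRing using (AlmostCommutativeRing; fromCommutativeRing)
import Tactic.RingSolver as RingSolver

ℚ-ring : AlmostCommutativeRing 0ℓ 0ℓ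
ℚ-ring = fromCommutativeRing ℚP.+-*-commutativeRing (λ _ → nothing)

toℚᵘ-/ : ∀ z k → toℚᵘ (z / suc k) ℚᵘ.≃ ℚᵘ.mkℚᵘ z k
toℚᵘ-/ z k = ℚP.toℚᵘ-fromℚᵘ (ℚᵘ.mkℚᵘ z k)

ι-homo-+ : ∀ x y → ι (x ℤ.+ y) ≡ ι x + ι y
ι-homo-+ x y = ℚP.toℚᵘ-injective (begin
  toℚᵘ (ι (x ℤ.+ y))              ≈⟨ toℚᵘ-/ (x ℤ.+ y) 0 ⟩
  ℚᵘ.mkℚᵘ (x ℤ.+ y) 0             ≈⟨ ℚᵘ.*≡* cross-multiplied ⟩
  ℚᵘ.mkℚᵘ x 0 ℚᵘ.+ ℚᵘ.mkℚᵘ y 0     ≈⟨ ℚᵘP.+-cong (toℚᵘ-/ x 0) (toℚᵘ-/ y 0) ⟨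
  toℚᵘ (ι x) ℚᵘ.+ toℚᵘ (ι y)       ≈⟨ ℚP.toℚᵘ-homo-+ (ι x) (ι y) ⟨
  toℚᵘ (ι x + ι y)                ∎)
  where
  open ℚᵘP.≃-Reasoning
  cross-multiplied : (x ℤ.+ y) ℤ.* 1ℤ ≡ (x ℤ.* 1ℤ ℤ.+ y ℤ.* 1ℤ) ℤ.* 1ℤ
  cross-multiplied = ℤ-Solver.solve (x ∷ y ∷ [])

ι-homo-* : ∀ x y → ι (x ℤ.* y) ≡ ι x * ι y
ι-homo-* x y = ℚP.toℚᵘ-injective (begin
  toℚᵘ (ι (x ℤ.* y))              ≈⟨ toℚᵘ-/ (x ℤ.* y) 0 ⟩
  ℚᵘ.mkℚᵘ (x ℤ.* y) 0             ≈⟨ ℚᵘ.*≡* refl ⟩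
  ℚᵘ.mkℚᵘ x 0 ℚᵘ.* ℚᵘ.mkℚᵘ y 0     ≈⟨ ℚᵘP.*-cong (toℚᵘ-/ x 0) (toℚᵘ-/ y 0) ⟨
  toℚᵘ (ι x) ℚᵘ.* toℚᵘ (ι y)       ≈⟨ ℚP.toℚᵘ-homo-* (ι x) (ι y) ⟨
  toℚᵘ (ι x * ι y)                ∎)
  where open ℚᵘP.≃-Reasoning

[m*n]/n≡m : ∀ m n .{{_ : ℕ.NonZero n}} → (+ (m ℕ.* n)) / n ≡ ι (+ m)
[m*n]/n≡m m (suc k) = ℚP.toℚᵘ-injective (begin
  toℚᵘ (+ (m ℕ.* suc k) / suc k)  ≈⟨ toℚᵘ-/ (+ (m ℕ.* suc k)) k ⟩
  ℚᵘ.mkℚᵘ (+ (m ℕ.* suc k)) k     ≈⟨ ℚᵘ.*≡* (trans (ℤP.*-identityʳ _) (ℤP.pos-* m (suc k))) ⟩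
  ℚᵘ.mkℚᵘ (+ m) 0                 ≈⟨ toℚᵘ-/ (+ m) 0 ⟨
  toℚᵘ (ι (+ m))                  ∎)
  where open ℚᵘP.≃-Reasoning

/≡ι*1/ : ∀ z k → z / suc k ≡ ι z * (1ℤ / suc k)
/≡ι*1/ z k = ℚP.toℚᵘ-injective (begin
  toℚᵘ (z / suc k)                  ≈⟨ toℚᵘ-/ z k ⟩
  ℚᵘ.mkℚᵘ z k                       ≈⟨ ℚᵘ.*≡* cross-multiplied ⟨
  ℚᵘ.mkℚᵘ z 0 ℚᵘ.* ℚᵘ.mkℚᵘ 1ℤ k      ≈⟨ ℚᵘP.*-cong (toℚᵘ-/ z 0) (toℚᵘ-/ 1ℤ k) ⟨
  toℚᵘ (ι z) ℚᵘ.* toℚᵘ (1ℤ / suc k)  ≈⟨ ℚP.toℚᵘ-homo-* (ι z) (1ℤ / suc k) ⟨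
  toℚᵘ (ι z * (1ℤ / suc k))         ∎)
  where
  open ℚᵘP.≃-Reasoning
  cross-multiplied : (z ℤ.* 1ℤ) ℤ.* + suc k ≡ z ℤ.* + suc (k ℕ.+ 0)
  cross-multiplied = cong₂ (λ u m → u ℤ.* + suc m) (ℤP.*-identityʳ z) (sym (ℕP.+-identityʳ k))

gcoef≡coeff : ∀ n d j → j < d ⊓ (n ∸ d) → gcoef n d (suc j) ≡ ι (coeff n d (suc j))
gcoef≡coeff n d j j<min = begin
  gcoef n d i
    ≡⟨ ℚP./-cong {{a!b!c!≢0 a (n ∸ d ∸ i) j}} {{a!b!c!≢0 a b j}}
                 (cong (λ m → + (m !)) (gcoef-level n d j i≤d d+i≤n))
                 (cong (λ m → a ! ℕ.* m ! ℕ.* j !) (ℕP.∸-+-assoc n d i)) ⟩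
  ((+ ((a ℕ.+ b ℕ.+ j) !)) / (a ! ℕ.* b ! ℕ.* j !)) {{a!b!c!≢0 a b j}}
    ≡⟨ cong (λ m → ((+ m) / (a ! ℕ.* b ! ℕ.* j !)) {{a!b!c!≢0 a b j}}) (multinomial-spec a b j) ⟨
  ((+ (multinomial a b j ℕ.* (a ! ℕ.* b ! ℕ.* j !))) / (a ! ℕ.* b ! ℕ.* j !)) {{a!b!c!≢0 a b j}}
    ≡⟨ [m*n]/n≡m (multinomial a b j) (a ! ℕ.* b ! ℕ.* j !) {{a!b!c!≢0 a b j}} ⟩
  ι (+ multinomial a b j)
    ≡⟨ cong ι (coeff≡multinomial n d j i≤d d+i≤n) ⟨
  ι (coeff n d i) ∎
  where
  open ≡-Reasoning
  i = suc j
  a = d ∸ i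
  b = n ∸ (d ℕ.+ i)
  i≤d : i ≤ d
  i≤d = ℕP.≤-trans j<min (ℕP.m⊓n≤m d (n ∸ d))
  i≤n∸d : i ≤ n ∸ d
  i≤n∸d = ℕP.≤-trans j<min (ℕP.m⊓n≤n d (n ∸ d))
  d≤n : d ≤ n
  d≤n = ℕP.≮⇒≥ λ n<d → ℕP.n≮0 (subst (i ≤_) (ℕP.m≤n⇒m∸n≡0 (ℕP.<⇒≤ n<d)) i≤n∸d)
  d+i≤n : d ℕ.+ i ≤ n
  d+i≤n = ℕP.≤-trans (ℕP.+-monoʳ-≤ d i≤n∸d) (ℕP.≤-reflexive (ℕP.m+[n∸m]≡n d≤n))

sum1to-cong : ∀ m {f h : ℕ → ℚ} → (∀ j → j < m → f (suc j) ≡ h (suc j)) →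
              sum1to m f ≡ sum1to m h
sum1to-cong zero    eq = refl
sum1to-cong (suc m) eq =
  cong₂ _+_ (sum1to-cong m (λ j j<m → eq j (ℕP.m<n⇒m<1+n j<m))) (eq m ℕP.≤-refl)

sum1to-vanishing : ∀ {m K} {f : ℕ → ℚ} → m ≤ K → (∀ j → m ≤ j → j < K → f (suc j) ≡ 0ℚ) →
                   sum1to K f ≡ sum1to m f
sum1to-vanishing {K = zero}  z≤n vanish = refl
sum1to-vanishing {m} {suc K} {f} m≤1+K vanish with ℕP.m≤n⇒m<n∨m≡n m≤1+K
... | inj₂ refl       = refl
... | inj₁ (s≤s m≤K) = begin
  sum1to K f + f (suc K)
    ≡⟨ cong₂ _+_ (sum1to-vanishing m≤K (λ j m≤j j<K → vanish j m≤j (ℕP.m<n⇒m<1+n j<K)))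
                 (vanish K m≤K ℕP.≤-refl) ⟩
  sum1to m f + 0ℚ
    ≡⟨ ℚP.+-identityʳ (sum1to m f) ⟩
  sum1to m f ∎
  where open ≡-Reasoning

poly : ℕ → (ℕ → ℤ) → ℚ → ℚ
poly L c t = sum1to L (λ i → ι (c i) * t ^ i)

poly-cong : ∀ L (c e : ℕ → ℤ) t → (∀ j → j < L → c (suc j) ≡ e (suc j)) →
            poly L c t ≡ poly L e t
poly-cong L c e t eq = sum1to-cong L (λ j j<L → cong (λ x → ι x * t ^ suc j) (eq j j<L))

poly-scale : ∀ L a c t → poly L (λ i → a ℤ.* c i) t ≡ ι a * poly L c t
poly-scale zero    a c t = sym (ℚP.*-zeroʳ (ι a))
poly-scale (suc L) a c t = begin
  poly L (λ i → a ℤ.* c i) t + ι (a ℤ.* cₗ) * T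
    ≡⟨ cong₂ (λ u v → u + v * T) (poly-scale L a c t) (ι-homo-* a cₗ) ⟩
  ι a * poly L c t + ι a * ι cₗ * T
    ≡⟨ distrib (ι a) (poly L c t) (ι cₗ) T ⟩
  ι a * (poly L c t + ι cₗ * T) ∎
  where
  open ≡-Reasoning
  cₗ = c (suc L)
  T = t ^ suc L
  distrib : ∀ α P x T → α * P + α * x * T ≡ α * (P + x * T)
  distrib α P x T = RingSolver.solve (α ∷ P ∷ x ∷ T ∷ []) ℚ-ring

poly-linear : ∀ L a b c e t →
  poly L (λ i → a ℤ.* c i ℤ.+ b ℤ.* e i) t ≡ ι a * poly L c t + ι b * poly L e t
poly-linear zero    a b c e t =
  sym (trans (cong₂ _+_ (ℚP.*-zeroʳ (ι a)) (ℚP.*-zeroʳ (ι b))) (ℚP.+-identityʳ 0ℚ))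
poly-linear (suc L) a b c e t = begin
  poly L (λ i → a ℤ.* c i ℤ.+ b ℤ.* e i) t + ι (a ℤ.* cₗ ℤ.+ b ℤ.* eₗ) * T
    ≡⟨ cong₂ (λ u v → u + v * T) (poly-linear L a b c e t) ι-linear ⟩
  ι a * poly L c t + ι b * poly L e t + (ι a * ι cₗ + ι b * ι eₗ) * T
    ≡⟨ distrib (ι a) (ι b) (poly L c t) (poly L e t) (ι cₗ) (ι eₗ) T ⟩
  ι a * (poly L c t + ι cₗ * T) + ι b * (poly L e t + ι eₗ * T) ∎
  where
  open ≡-Reasoning
  cₗ = c (suc L)
  eₗ = e (suc L)
  T = t ^ suc L
  ι-linear : ι (a ℤ.* cₗ ℤ.+ b ℤ.* eₗ) ≡ ι a * ι cₗ + ι b * ι eₗ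
  ι-linear = trans (ι-homo-+ (a ℤ.* cₗ) (b ℤ.* eₗ)) (cong₂ _+_ (ι-homo-* a cₗ) (ι-homo-* b eₗ))
  distrib : ∀ α β P Q x y T → α * P + β * Q + (α * x + β * y) * T ≡ α * (P + x * T) + β * (Q + y * T)
  distrib α β P Q x y T = RingSolver.solve (α ∷ β ∷ P ∷ Q ∷ x ∷ y ∷ T ∷ []) ℚ-ring

poly-shift : ∀ K c t → c 0 ≡ 0ℤ → t * poly K c t ≡ poly (suc K) (λ i → c (i ∸ 1)) t
poly-shift zero    c t c0≡0 rewrite c0≡0 =
  trans (ℚP.*-zeroʳ t) (sym (trans (ℚP.+-identityˡ _) (ℚP.*-zeroˡ (t * 1ℚ))))
poly-shift (suc K) c t c0≡0 = begin
  t * (poly K c t + ι cₖ * t ^ suc K)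
    ≡⟨ distrib t (poly K c t) (ι cₖ) (t ^ suc K) ⟩
  t * poly K c t + ι cₖ * t ^ suc (suc K)
    ≡⟨ cong (_+ ι cₖ * t ^ suc (suc K)) (poly-shift K c t c0≡0) ⟩
  poly (suc K) (λ i → c (i ∸ 1)) t + ι cₖ * t ^ suc (suc K) ∎
  where
  open ≡-Reasoning
  cₖ = c (suc K)
  distrib : ∀ t P x T → t * (P + x * T) ≡ t * P + x * (t * T)
  distrib t P x T = RingSolver.solve (t ∷ P ∷ x ∷ T ∷ []) ℚ-ring

g≡poly : ∀ n d L → d ⊓ (n ∸ d) ≤ L → ∀ t → g n d t ≡ poly L (coeff n d) t
g≡poly n d L min≤L t = begin
  g n d t
    ≡⟨ sum1to-cong (d ⊓ (n ∸ d)) (λ j j<min → cong (_* t ^ suc j) (gcoef≡coeff n d j j<min)) ⟩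
  poly (d ⊓ (n ∸ d)) (coeff n d) t
    ≡⟨ sum1to-vanishing min≤L vanishing ⟨
  poly L (coeff n d) t ∎
  where
  open ≡-Reasoning
  vanishing : ∀ j → d ⊓ (n ∸ d) ≤ j → j < L → ι (coeff n d (suc j)) * t ^ suc j ≡ 0ℚ
  vanishing j min≤j _ = trans (cong (λ x → ι x * t ^ suc j) (coeff-vanishes n d (suc j) (s≤s min≤j)))
                              (ℚP.*-zeroˡ (t ^ suc j))

t*g≡poly : ∀ n d K → d ⊓ (n ∸ d) ≤ K → ∀ t →
           t * g n d t ≡ poly (suc K) (λ i → coeff n d (i ∸ 1)) t
t*g≡poly n d K min≤K t =
  trans (cong (t *_) (g≡poly n d K min≤K t)) (poly-shift K (coeff n d) t (coeff-zero n d))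

g-recurrence₁ : ∀ n d → 2 ≤ n → 2 ≤ d → ∀ t →
  ι (+ d ℤ.- 1ℤ) * g n d t
    ≡ ι (+ n ℤ.- + d) * g n (d ∸ 1) t + ι (+ n ℤ.+ 1ℤ ℤ.- + 2 ℤ.* + d) * (t * g (n ∸ 1) (d ∸ 1) t)
g-recurrence₁ n@(suc (suc n₂)) d@(suc (suc d₂)) (s≤s (s≤s z≤n)) (s≤s (s≤s z≤n)) t = begin
  ι D-1 * g n d t
    ≡⟨ cong (ι D-1 *_) (g≡poly n d L (d⊓[n∸d]≤n∸k n d (s≤s z≤n)) t) ⟩
  ι D-1 * poly L (coeff n d) t
    ≡⟨ poly-scale L D-1 (coeff n d) t ⟨
  poly L (λ i → D-1 ℤ.* coeff n d i) t
    ≡⟨ poly-cong L (λ i → D-1 ℤ.* coeff n d i)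
                 (λ i → A ℤ.* coeff n (suc d₂) i ℤ.+ B ℤ.* coeff (suc n₂) (suc d₂) (i ∸ 1)) t
                 (λ j j<L → coeffℤ-recurrence₁ (+ n) (+ d) (+ suc j) _
                                               ([+m]-[+n]≡+[1+m∸1+n] (s≤s j<L))) ⟩
  poly L (λ i → A ℤ.* coeff n (suc d₂) i ℤ.+ B ℤ.* coeff (suc n₂) (suc d₂) (i ∸ 1)) t
    ≡⟨ poly-linear L A B (coeff n (suc d₂)) (λ i → coeff (suc n₂) (suc d₂) (i ∸ 1)) t ⟩
  ι A * poly L (coeff n (suc d₂)) t + ι B * poly L (λ i → coeff (suc n₂) (suc d₂) (i ∸ 1)) t
    ≡⟨ cong₂ (λ u v → ι A * u + ι B * v)
             (g≡poly n (suc d₂) L (d⊓[n∸d]≤n∸k n (suc d₂) (s≤s z≤n)) t)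
             (t*g≡poly (suc n₂) (suc d₂) n₂ (d⊓[n∸d]≤n∸k (suc n₂) (suc d₂) (s≤s z≤n)) t) ⟨
  ι A * g n (suc d₂) t + ι B * (t * g (suc n₂) (suc d₂) t) ∎
  where
  open ≡-Reasoning
  L = suc n₂
  D-1 = + d ℤ.- 1ℤ
  A = + n ℤ.- + d
  B = + n ℤ.+ 1ℤ ℤ.- + 2 ℤ.* + d

g-recurrence₂ : ∀ n d → 2 ≤ n → 2 ≤ d → ∀ t →
  (ι ((+ n ℤ.- + 2 ℤ.* + d) ℤ.* (+ n ℤ.+ 1ℤ ℤ.- + 2 ℤ.* + d)) * t
    + ι ((+ d ℤ.- 1ℤ) ℤ.* (+ d ℤ.- 1ℤ))) * g n d t
    ≡ ι ((+ d ℤ.- 1ℤ) ℤ.* (+ n ℤ.- + d)) * g n (d ∸ 1) t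
      + ι ((+ n ℤ.+ 1ℤ ℤ.- + 2 ℤ.* + d) ℤ.* (+ n ℤ.- 1ℤ ℤ.- + d)) * (t * g (n ∸ 1) d t)
g-recurrence₂ n@(suc (suc n₂)) d@(suc (suc d₂)) (s≤s (s≤s z≤n)) (s≤s (s≤s z≤n)) t = begin
  (ι P * t + ι Q) * g n d t
    ≡⟨ distrib (ι P) (ι Q) t (g n d t) ⟩
  ι P * (t * g n d t) + ι Q * g n d t
    ≡⟨ cong₂ (λ u v → ι P * u + ι Q * v)
             (t*g≡poly n d n₂ (d⊓[n∸d]≤n∸k n d (s≤s (s≤s z≤n))) t)
             (g≡poly n d L (d⊓[n∸d]≤n∸k n d (s≤s z≤n)) t) ⟩
  ι P * poly L (λ i → coeff n d (i ∸ 1)) t + ι Q * poly L (coeff n d) t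
    ≡⟨ poly-linear L P Q (λ i → coeff n d (i ∸ 1)) (coeff n d) t ⟨
  poly L (λ i → P ℤ.* coeff n d (i ∸ 1) ℤ.+ Q ℤ.* coeff n d i) t
    ≡⟨ poly-cong L (λ i → P ℤ.* coeff n d (i ∸ 1) ℤ.+ Q ℤ.* coeff n d i)
                 (λ i → A ℤ.* coeff n (suc d₂) i ℤ.+ B ℤ.* coeff (suc n₂) d (i ∸ 1)) t
                 (λ j j<L → coeffℤ-recurrence₂ (+ n) (+ d) (+ suc j) _
                                               ([+m]-[+n]≡+[1+m∸1+n] (s≤s j<L))) ⟩
  poly L (λ i → A ℤ.* coeff n (suc d₂) i ℤ.+ B ℤ.* coeff (suc n₂) d (i ∸ 1)) t
    ≡⟨ poly-linear L A B (coeff n (suc d₂)) (λ i → coeff (suc n₂) d (i ∸ 1)) t ⟩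
  ι A * poly L (coeff n (suc d₂)) t + ι B * poly L (λ i → coeff (suc n₂) d (i ∸ 1)) t
    ≡⟨ cong₂ (λ u v → ι A * u + ι B * v)
             (g≡poly n (suc d₂) L (d⊓[n∸d]≤n∸k n (suc d₂) (s≤s z≤n)) t)
             (t*g≡poly (suc n₂) d n₂ (d⊓[n∸d]≤n∸k (suc n₂) d (s≤s z≤n)) t) ⟨
  ι A * g n (suc d₂) t + ι B * (t * g (suc n₂) d t) ∎
  where
  open ≡-Reasoning
  L = suc n₂
  P = (+ n ℤ.- + 2 ℤ.* + d) ℤ.* (+ n ℤ.+ 1ℤ ℤ.- + 2 ℤ.* + d)
  Q = (+ d ℤ.- 1ℤ) ℤ.* (+ d ℤ.- 1ℤ)
  A = (+ d ℤ.- 1ℤ) ℤ.* (+ n ℤ.- + d)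
  B = (+ n ℤ.+ 1ℤ ℤ.- + 2 ℤ.* + d) ℤ.* (+ n ℤ.- 1ℤ ℤ.- + d)
  distrib : ∀ p q t G → (p * t + q) * G ≡ p * (t * G) + q * G
  distrib p q t G = RingSolver.solve (p ∷ q ∷ t ∷ G ∷ []) ℚ-ring

cancel-by-inverse : ∀ c c⁻¹ x y → c⁻¹ * c ≡ 1ℚ → c * x ≡ y → x ≡ c⁻¹ * y
cancel-by-inverse c c⁻¹ x y c⁻¹*c≡1 c*x≡y = begin
  x               ≡⟨ ℚP.*-identityˡ x ⟨
  1ℚ * x          ≡⟨ cong (_* x) c⁻¹*c≡1 ⟨
  c⁻¹ * c * x     ≡⟨ ℚP.*-assoc c⁻¹ c x ⟩
  c⁻¹ * (c * x)   ≡⟨ cong (c⁻¹ *_) c*x≡y ⟩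
  c⁻¹ * y         ∎
  where open ≡-Reasoning

isolate-/ : ∀ k a b x y w t → ι (+ suc k) * x ≡ ι a * y + ι b * (t * w) →
            x ≡ (a / suc k) * y + (t * (b / suc k)) * w
isolate-/ k a b x y w t eq = begin
  x
    ≡⟨ cancel-by-inverse (ι (+ suc k)) r x _ r*[1+k]≡1 eq ⟩
  r * (ι a * y + ι b * (t * w))
    ≡⟨ distrib r (ι a) (ι b) y w t ⟩
  ι a * r * y + t * (ι b * r) * w
    ≡⟨ cong₂ (λ u v → u * y + t * v * w) (/≡ι*1/ a k) (/≡ι*1/ b k) ⟨
  (a / suc k) * y + (t * (b / suc k)) * w ∎
  where
  open ≡-Reasoning
  r = 1ℤ / suc k
  r*[1+k]≡1 : r * ι (+ suc k) ≡ 1ℚ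
  r*[1+k]≡1 = begin
    r * ι (+ suc k)          ≡⟨ ℚP.*-comm r (ι (+ suc k)) ⟩
    ι (+ suc k) * r          ≡⟨ /≡ι*1/ (+ suc k) k ⟨
    + suc k / suc k          ≡⟨ cong (λ m → + m / suc k) (ℕP.*-identityˡ (suc k)) ⟨
    + (1 ℕ.* suc k) / suc k  ≡⟨ [m*n]/n≡m 1 (suc k) ⟩
    1ℚ                       ∎
  distrib : ∀ r α β y w t → r * (α * y + β * (t * w)) ≡ α * r * y + t * (β * r) * w
  distrib r α β y w t = RingSolver.solve (r ∷ α ∷ β ∷ y ∷ w ∷ t ∷ []) ℚ-ring

isolate-÷ : ∀ c (c≢0 : c ≢ 0ℚ) a b x y w t → c * x ≡ a * y + b * (t * w) →
            x ≡ (a ÷ c) {{≢-nonZero c≢0}} * y + ((b * t) ÷ c) {{≢-nonZero c≢0}} * w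
isolate-÷ c c≢0 a b x y w t eq =
  trans (cancel-by-inverse c c⁻¹ x _ (ℚP.*-inverseˡ c {{≢-nonZero c≢0}}) eq) (distrib c⁻¹ a b y w t)
  where
  c⁻¹ = (1/ c) {{≢-nonZero c≢0}}
  distrib : ∀ r α β y w t → r * (α * y + β * (t * w)) ≡ α * r * y + β * t * r * w
  distrib r α β y w t = RingSolver.solve (r ∷ α ∷ β ∷ y ∷ w ∷ t ∷ []) ℚ-ring

theorem2p3 : (n d : ℕ) → 3 ≤ n → (h : 2 ≤ d) → d ≤ n ∸ 1 →
    ((t : ℚ) →
      g n d t
        ≡ (((+ n ℤ.- + d) / (d ∸ 1)) {{2≤⇒pred-nonZero h}}) * g n (d ∸ 1) t
          + (t * ((+ n ℤ.+ + 1 ℤ.- + 2 ℤ.* + d) / (d ∸ 1)) {{2≤⇒pred-nonZero h}})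
            * g (n ∸ 1) (d ∸ 1) t)
    ×
    ((t : ℚ) →
      (nz : ι ((+ n ℤ.- + 2 ℤ.* + d) ℤ.* (+ n ℤ.+ + 1 ℤ.- + 2 ℤ.* + d)) * t
              + ι ((+ d ℤ.- + 1) ℤ.* (+ d ℤ.- + 1)) ≢ 0ℚ) →
      g n d t
        ≡ (ι ((+ d ℤ.- + 1) ℤ.* (+ n ℤ.- + d))
            ÷ (ι ((+ n ℤ.- + 2 ℤ.* + d) ℤ.* (+ n ℤ.+ + 1 ℤ.- + 2 ℤ.* + d)) * t
                + ι ((+ d ℤ.- + 1) ℤ.* (+ d ℤ.- + 1)))) {{≢-nonZero nz}}
            * g n (d ∸ 1) t
          + ((ι ((+ n ℤ.+ + 1 ℤ.- + 2 ℤ.* + d) ℤ.* (+ n ℤ.- + 1 ℤ.- + d)) * t)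
            ÷ (ι ((+ n ℤ.- + 2 ℤ.* + d) ℤ.* (+ n ℤ.+ + 1 ℤ.- + 2 ℤ.* + d)) * t
                + ι ((+ d ℤ.- + 1) ℤ.* (+ d ℤ.- + 1)))) {{≢-nonZero nz}}
            * g (n ∸ 1) d t)
theorem2p3 n d@(suc (suc d₂)) 3≤n 2≤d@(s≤s (s≤s z≤n)) _ =
  (λ t → isolate-/ d₂ (+ n ℤ.- + d) (+ n ℤ.+ 1ℤ ℤ.- + 2 ℤ.* + d)
                   (g n d t) (g n (d ∸ 1) t) (g (n ∸ 1) (d ∸ 1) t) t
                   (g-recurrence₁ n d 2≤n 2≤d t)) ,
  (λ t nz → isolate-÷ (ι P * t + ι Q) nz (ι A) (ι B)
                      (g n d t) (g n (d ∸ 1) t) (g (n ∸ 1) d t) t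
                      (g-recurrence₂ n d 2≤n 2≤d t))
  where
  2≤n = ℕP.<⇒≤ 3≤n
  P = (+ n ℤ.- + 2 ℤ.* + d) ℤ.* (+ n ℤ.+ 1ℤ ℤ.- + 2 ℤ.* + d)
  Q = (+ d ℤ.- 1ℤ) ℤ.* (+ d ℤ.- 1ℤ)
  A = (+ d ℤ.- 1ℤ) ℤ.* (+ n ℤ.- + d)
  B = (+ n ℤ.+ 1ℤ ℤ.- + 2 ℤ.* + d) ℤ.* (+ n ℤ.- 1ℤ ℤ.- + d)
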